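{- Let $G$ be a finite simple graph on vertices $v_1,\ldots,v_n$, $n\ge1$, and define $$q(k_1,\ldots,k_n)(x)=\sum_{\ell_1=0}^1\cdots\sum_{\ell_n=0}^1(-1)^{n+\ell}\,q(G[\ell_1,\ldots,\ell_n])(x)\prod_{i=1}^n\sum_{j=1-\ell_i}^{k_i-1}x^j,$$ where $\ell=\sum_{i=1}^n\ell_i$. Then for all $k_1,\ldots,k_n\ge1$, $q(G[k_1,\ldots,k_n])(x)=q(k_1,\ldots,k_n)(x)$.
   Context: $G[k_1,\ldots,k_n]$ denotes the graph obtained from $G$ by replacing each $v_i$ with $k_i$ pairwise non-adjacent copies, each adjacent to all copies of $v_j$ for $v_iv_j\in E(G)$; when $k_i=0$ the vertex $v_i$ is deleted, so for $\ell_i\in\{0,1\}$, $G[\ell_1,\ldots,\ell_n]$ is the induced subgraph on $\{v_i:\ell_i=1\}$. An empty sum equals $0$. The interlace polynomial $q$ is the unique map from finite simple graphs to $\mathbb{Z}[x]$ with $q(E_n)=x^n$ for the edgeless graph $E_n$ on $n$ vertices ($q$ of the graph with no vertices is $1$) and $q(G)=q(G-a)+q(G^{ab}-b)$ for every edge $ab$ of $G$; here the pivot $G^{ab}$ is obtained by partitioning the vertices other than $a,b$ into (1) adjacent to $a$ only, (2) adjacent to $b$ only, (3) adjacent to both, (4) adjacent to neither, and toggling the adjacency of every pair $\{x,y\}$ with $x,y$ in two different classes among (1),(2),(3). -}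

module Defs where

open import Data.Bool using (Bool; true; false; _∧_; _∨_; _xor_; not; if_then_else_)
open import Data.Nat as ℕ using (ℕ; zero; suc; _∸_)
open import Data.Integer as ℤ using (ℤ; +_; -[1+_])
open import Data.Fin as Fin using (Fin; zero; suc; punchIn; splitAt; _≟_)
open import Data.Vec as Vec using (Vec; []; _∷_; lookup; tabulate; replicate)
open import Data.List as List using (List; []; _∷_; upTo; foldr; concatMap)
open import Data.Sum using (inj₁; inj₂)
open import Relation.Nullary.Decidable using (⌊_⌋)
open import Relation.Binary.PropositionalEquality using (_≡_)

-- Integer polynomials ℤ[x] as coefficient lists (constant term first),
-- compared by equality of all coefficients (so trailing zeros are irrelevant).

Poly : Set
Poly = List ℤ

coeff : Poly → ℕ → ℤ
coeff []       _       = + 0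
coeff (c ∷ p)  zero    = c
coeff (c ∷ p)  (suc i) = coeff p i

infix 4 _≈ₚ_
_≈ₚ_ : Poly → Poly → Set
p ≈ₚ r = ∀ i → coeff p i ≡ coeff r i

infixl 6 _+ₚ_
_+ₚ_ : Poly → Poly → Poly
[]      +ₚ r       = r
(c ∷ p) +ₚ []      = c ∷ p
(c ∷ p) +ₚ (d ∷ r) = (c ℤ.+ d) ∷ (p +ₚ r)

_·ₚ_ : ℤ → Poly → Poly
a ·ₚ p = List.map (a ℤ.*_) p

infixl 7 _*ₚ_
_*ₚ_ : Poly → Poly → Poly
[]      *ₚ r = []
(c ∷ p) *ₚ r = (c ·ₚ r) +ₚ (+ 0 ∷ (p *ₚ r))

constₚ : ℤ → Poly
constₚ a = a ∷ []

oneₚ : Poly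
oneₚ = constₚ (+ 1)

X^ : ℕ → Poly
X^ zero    = oneₚ
X^ (suc n) = + 0 ∷ X^ n

sumₚ : List Poly → Poly
sumₚ = foldr _+ₚ_ []

-- Σ_{j=a}^{b} x^j  (empty, i.e. 0, when a > b)
rangeSum : ℕ → ℕ → Poly
rangeSum a b = sumₚ (List.map (λ j → X^ (a ℕ.+ j)) (upTo (suc b ∸ a)))

prodVecₚ : ∀ {n} → Vec Poly n → Poly
prodVecₚ = Vec.foldr _ _*ₚ_ oneₚ

Adj : ℕ → Set
Adj n = Vec (Vec Bool n) n

adj : ∀ {n} → Adj n → Fin n → Fin n → Bool
adj A i j = lookup (lookup A i) j

record Simple {n : ℕ} (A : Adj n) : Set where
  field
    symmetric : ∀ i j → adj A i j ≡ adj A j i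
    loopless  : ∀ i → adj A i i ≡ false

edgeless : (n : ℕ) → Adj n
edgeless n = replicate n (replicate n false)

delete : ∀ {n} → Fin (suc n) → Adj (suc n) → Adj n
delete v A = tabulate λ i → tabulate λ j → adj A (punchIn v i) (punchIn v j)

-- pivot G^{ab}: for vertices x,y other than a,b, toggle adjacency of x,y
-- iff x,y lie in two different classes among
--   (1) adjacent to a only, (2) adjacent to b only, (3) adjacent to both.
pivot : ∀ {n} → Fin n → Fin n → Adj n → Adj n
pivot {n} a b A = tabulate λ x → tabulate λ y → adj A x y xor toggle x y
  where
  other : Fin n → Bool
  other x = not ⌊ x ≟ a ⌋ ∧ not ⌊ x ≟ b ⌋
  inClass123 : Fin n → Bool
  inClass123 x = other x ∧ (adj A x a ∨ adj A x b)
  sameClass : Fin n → Fin n → Bool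
  sameClass x y = not (adj A x a xor adj A y a) ∧ not (adj A x b xor adj A y b)
  toggle : Fin n → Fin n → Bool
  toggle x y = inClass123 x ∧ inClass123 y ∧ not (sameClass x y)

record IsInterlace (q : (n : ℕ) → Adj n → Poly) : Set where
  field
    edgeless-rule : ∀ n → q n (edgeless n) ≈ₚ X^ n
    edge-rule     : ∀ m (A : Adj (suc m)) → Simple A → ∀ a b → adj A a b ≡ true →
                    q (suc m) A ≈ₚ q m (delete a A) +ₚ q m (delete b (pivot a b A))

-- Blow-up G[k_1,…,k_n]: vertex set Fin (k_1 + … + k_n); the first k_1
-- vertices are the copies of v_1, the next k_2 those of v_2, etc.

owner : ∀ {n} (ks : Vec ℕ n) → Fin (Vec.sum ks) → Fin n
owner (k ∷ ks) j with splitAt k j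
... | inj₁ _  = zero
... | inj₂ j′ = suc (owner ks j′)

blowup : ∀ {n} → Adj n → (ks : Vec ℕ n) → Adj (Vec.sum ks)
blowup A ks = tabulate λ i → tabulate λ j → adj A (owner ks i) (owner ks j)

binVecs : (n : ℕ) → List (Vec ℕ n)
binVecs zero    = [] ∷ []
binVecs (suc n) = concatMap (λ v → (0 ∷ v) ∷ (1 ∷ v) ∷ []) (binVecs n)

signₚ : ℕ → Poly
signₚ m = constₚ (-[1+ 0 ] ℤ.^ m)

qFormula : (q : (n : ℕ) → Adj n → Poly) → ∀ {n} → Adj n → Vec ℕ n → Poly
qFormula q {n} A ks = sumₚ (List.map term (binVecs n))
  where
  term : Vec ℕ n → Poly
  term ℓs = signₚ (n ℕ.+ Vec.sum ℓs)
            *ₚ q (Vec.sum ℓs) (blowup A ℓs)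
            *ₚ prodVecₚ (Vec.zipWith (λ ℓ k → rangeSum (1 ∸ ℓ) (k ∸ 1)) ℓs ks)

-- Write Q(u₁ … uₗ) for q of the subgraph of G induced by a sequence of vertices, where
-- repeated vertices become non-adjacent copies; G[k₁,…,kₙ] is the sequence in which each vᵢ
-- occurs kᵢ times, and Q does not depend on the order of the sequence. The recursion for q
-- gives that an isolated vertex contributes a factor x, and that two copies u, u of a vertex
-- satisfy Q(u u T) = Q(u T) + x (Q(u T) − Q(T)): if u has a neighbour w in T, pivoting on the
-- edge from the second copy to w isolates the first copy, and otherwise both are isolated.
-- By induction on k this yields Q(uᵏ T) = (1 − Sₖ) Q(T) + Sₖ Q(u T) with
-- Sₖ = 1 + x + … + x^(k−1). Expanding all n blocks in this way gives a sum over ℓ ∈ {0,1}ⁿ,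
-- and (−1)^(1+ℓᵢ) Σ_{j=1−ℓᵢ}^{kᵢ−1} x^j is 1 − S_{kᵢ} for ℓᵢ = 0 and S_{kᵢ} for ℓᵢ = 1.
module Submission where

open import Defs
open import Data.Nat using (ℕ; _≤_)
open import Data.Vec using (Vec; lookup; sum)
open import Data.Fin using (Fin)

open import Algebra.Bundles using (CommutativeRing)
open import Data.Bool using (Bool; true; false; _∧_; _∨_; _xor_; not)
open import Data.Bool.Properties using (∧-assoc; ∧-comm; ∧-zeroʳ; xor-comm; xor-same; ¬-not)
  renaming (_≟_ to _≟ᵇ_)
open import Data.Fin as Fin using (zero; suc; punchIn; _≟_)
open import Data.Fin.Permutation
  using (Permutation; _⟨$⟩ʳ_; _⟨$⟩ˡ_; inverseʳ; remove; punchIn-permute′; cast-id; ↔⇒≡)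
open import Data.Fin.Properties using (any?; suc-injective; punchInᵢ≢i)
open import Data.Integer as ℤ using (ℤ; +_; -[1+_])
import Data.Integer.Properties as ℤ
open import Data.List as List using (List; []; _∷_; [_]; _++_)
open import Data.List.Properties using (map-applyUpTo; map-∘; ++-assoc; length-++; length-replicate)
open import Data.List.Relation.Binary.Permutation.Propositional using (_↭_; ↭⇒↭ₛ)
open import Data.List.Relation.Binary.Permutation.Propositional.Properties using (shifts)
import Data.List.Relation.Binary.Permutation.Setoid as SetoidPermutation
import Data.List.Relation.Binary.Permutation.Setoid.Properties as SetoidPermutationProperties
open import Data.Maybe using (Maybe; just; nothing)
open import Data.Nat as ℕ using (zero; suc; _∸_; z≤n; s≤s)
import Data.Nat.Tactic.RingSolver as ℕ-Solver
open import Data.Product using (_×_; _,_; ∃₂)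
open import Data.Sum using (_⊎_; inj₁; inj₂)
open import Data.Vec as Vec using ([]; _∷_; tabulate)
open import Data.Vec.Properties using (lookup∘tabulate; lookup-replicate)
open import Data.Vec.Relation.Binary.Pointwise.Extensional using (ext; Pointwise-≡⇒≡)
open import Data.Vec.Relation.Unary.All using (All; []; _∷_)
open import Function using (_∘_; id)
open import Function.Bundles using (Injection)
open import Function.Definitions using (Injective)
open import Function.Properties.Inverse using (↔⇒↣)
open import Relation.Binary.Bundles using (Setoid)
open import Relation.Binary.PropositionalEquality hiding ([_]) renaming (setoid to ≡-setoid)
import Relation.Binary.Reasoning.Setoid as SetoidReasoning
open import Relation.Nullary using (yes; no; contradiction)
open import Relation.Nullary.Decidable using (⌊_⌋; isYes≗does; dec-true; dec-false)
import Tactic.RingSolver.Core.AlmostCommutativeRing as ACR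
open import Tactic.RingSolver using (solve-∀)

-- The polynomial ring ℤ[x]

-- A record rather than _≈ₚ_ itself, so that both polynomials can be inferred from a proof.
infix 4 _≈_
record _≈_ (p r : Poly) : Set where
  constructor coeffwise
  field coeff-≡ : p ≈ₚ r
open _≈_ public

infix 8 -ₚ_
-ₚ_ : Poly → Poly
-ₚ_ = List.map (λ c → ℤ.- c)

shift : Poly → Poly
shift p = + 0 ∷ p

≈-refl : ∀ {p} → p ≈ p
≈-refl = coeffwise λ _ → refl

≈-sym : ∀ {p r} → p ≈ r → r ≈ p
≈-sym (coeffwise e) = coeffwise λ i → sym (e i)

≈-trans : ∀ {p r s} → p ≈ r → r ≈ s → p ≈ s
≈-trans (coeffwise e) (coeffwise f) = coeffwise λ i → trans (e i) (f i)

≡⇒≈ : ∀ {p r} → p ≡ r → p ≈ r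
≡⇒≈ refl = ≈-refl

≈-setoid : Setoid _ _
≈-setoid = record
  { _≈_           = _≈_
  ; isEquivalence = record { refl = ≈-refl ; sym = ≈-sym ; trans = ≈-trans }
  }

module ≈-Reasoning = SetoidReasoning ≈-setoid

∷-cong : ∀ {c d p r} → c ≡ d → p ≈ r → c ∷ p ≈ d ∷ r
∷-cong c≡d (coeffwise e) = coeffwise λ { zero → c≡d ; (suc i) → e i }

∷-injective : ∀ {c d p r} → c ∷ p ≈ d ∷ r → c ≡ d × p ≈ r
∷-injective (coeffwise e) = e zero , coeffwise (e ∘ suc)

shift-cong : ∀ {p r} → p ≈ r → shift p ≈ shift r
shift-cong = ∷-cong refl

[]≈shift[] : [] ≈ shift []
[]≈shift[] = coeffwise λ { zero → refl ; (suc i) → refl }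

[]≈∷ : ∀ {d r} → + 0 ≡ d → [] ≈ r → [] ≈ d ∷ r
[]≈∷ 0≡d []≈r = ≈-trans []≈shift[] (∷-cong 0≡d []≈r)

[]≈∷-inverse : ∀ {d r} → [] ≈ d ∷ r → + 0 ≡ d × [] ≈ r
[]≈∷-inverse []≈d∷r = ∷-injective (≈-trans (≈-sym []≈shift[]) []≈d∷r)

coeff-+ : ∀ p r i → coeff (p +ₚ r) i ≡ coeff p i ℤ.+ coeff r i
coeff-+ []      r       i       = sym (ℤ.+-identityˡ _)
coeff-+ (c ∷ p) []      i       = sym (ℤ.+-identityʳ _)
coeff-+ (c ∷ p) (d ∷ r) zero    = refl
coeff-+ (c ∷ p) (d ∷ r) (suc i) = coeff-+ p r i

coeff-map : ∀ (f : ℤ → ℤ) → f (+ 0) ≡ + 0 → ∀ p i → coeff (List.map f p) i ≡ f (coeff p i)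
coeff-map f f0≡0 []      i       = sym f0≡0
coeff-map f f0≡0 (c ∷ p) zero    = refl
coeff-map f f0≡0 (c ∷ p) (suc i) = coeff-map f f0≡0 p i

+-cong : ∀ {p p′ r r′} → p ≈ p′ → r ≈ r′ → p +ₚ r ≈ p′ +ₚ r′
+-cong {p} {p′} {r} {r′} (coeffwise e) (coeffwise f) = coeffwise λ i →
  trans (coeff-+ p r i) (trans (cong₂ ℤ._+_ (e i) (f i)) (sym (coeff-+ p′ r′ i)))

+-congˡ : ∀ p {r r′} → r ≈ r′ → p +ₚ r ≈ p +ₚ r′
+-congˡ p = +-cong ≈-refl

+-congʳ : ∀ {p p′} r → p ≈ p′ → p +ₚ r ≈ p′ +ₚ r
+-congʳ r p≈p′ = +-cong p≈p′ ≈-refl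

map-cong : ∀ (f : ℤ → ℤ) → f (+ 0) ≡ + 0 → ∀ {p r} → p ≈ r → List.map f p ≈ List.map f r
map-cong f f0≡0 {p} {r} (coeffwise e) = coeffwise λ i →
  trans (coeff-map f f0≡0 p i) (trans (cong f (e i)) (sym (coeff-map f f0≡0 r i)))

·-cong : ∀ a {p r} → p ≈ r → a ·ₚ p ≈ a ·ₚ r
·-cong a = map-cong (a ℤ.*_) (ℤ.*-zeroʳ a)

-‿cong : ∀ {p r} → p ≈ r → -ₚ p ≈ -ₚ r
-‿cong = map-cong (λ c → ℤ.- c) refl

+-identityʳ : ∀ p → p +ₚ [] ≡ p
+-identityʳ []      = refl
+-identityʳ (c ∷ p) = refl

+-comm : ∀ p r → p +ₚ r ≡ r +ₚ p
+-comm []      r       = sym (+-identityʳ r)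
+-comm (c ∷ p) []      = refl
+-comm (c ∷ p) (d ∷ r) = cong₂ _∷_ (ℤ.+-comm c d) (+-comm p r)

+-assoc : ∀ p r s → (p +ₚ r) +ₚ s ≡ p +ₚ (r +ₚ s)
+-assoc []      r       s       = refl
+-assoc (c ∷ p) []      s       = refl
+-assoc (c ∷ p) (d ∷ r) []      = refl
+-assoc (c ∷ p) (d ∷ r) (e ∷ s) = cong₂ _∷_ (ℤ.+-assoc c d e) (+-assoc p r s)

+-interchange : ∀ p r s t → (p +ₚ r) +ₚ (s +ₚ t) ≡ (p +ₚ s) +ₚ (r +ₚ t)
+-interchange p r s t = begin
  (p +ₚ r) +ₚ (s +ₚ t)  ≡⟨ +-assoc p r (s +ₚ t) ⟩
  p +ₚ (r +ₚ (s +ₚ t))  ≡⟨ cong (p +ₚ_) (+-assoc r s t) ⟨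
  p +ₚ ((r +ₚ s) +ₚ t)  ≡⟨ cong (λ u → p +ₚ (u +ₚ t)) (+-comm r s) ⟩
  p +ₚ ((s +ₚ r) +ₚ t)  ≡⟨ cong (p +ₚ_) (+-assoc s r t) ⟩
  p +ₚ (s +ₚ (r +ₚ t))  ≡⟨ +-assoc p s (r +ₚ t) ⟨
  (p +ₚ s) +ₚ (r +ₚ t)  ∎
  where open ≡-Reasoning

-‿inverseˡ : ∀ p → -ₚ p +ₚ p ≈ []
-‿inverseˡ []      = ≈-refl
-‿inverseˡ (c ∷ p) = ≈-sym ([]≈∷ (sym (ℤ.+-inverseˡ c)) (≈-sym (-‿inverseˡ p)))

-‿inverseʳ : ∀ p → p +ₚ -ₚ p ≈ []
-‿inverseʳ p = ≈-trans (≡⇒≈ (+-comm p (-ₚ p))) (-‿inverseˡ p)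

·-distribˡ : ∀ a p r → a ·ₚ (p +ₚ r) ≡ a ·ₚ p +ₚ a ·ₚ r
·-distribˡ a []      r       = refl
·-distribˡ a (c ∷ p) []      = refl
·-distribˡ a (c ∷ p) (d ∷ r) = cong₂ _∷_ (ℤ.*-distribˡ-+ a c d) (·-distribˡ a p r)

·-distribʳ : ∀ a b p → (a ℤ.+ b) ·ₚ p ≡ a ·ₚ p +ₚ b ·ₚ p
·-distribʳ a b []      = refl
·-distribʳ a b (c ∷ p) = cong₂ _∷_ (ℤ.*-distribʳ-+ c a b) (·-distribʳ a b p)

·-assoc : ∀ a b p → a ·ₚ (b ·ₚ p) ≡ (a ℤ.* b) ·ₚ p
·-assoc a b []      = refl
·-assoc a b (c ∷ p) = cong₂ _∷_ (sym (ℤ.*-assoc a b c)) (·-assoc a b p)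

·-identityˡ : ∀ p → (+ 1) ·ₚ p ≡ p
·-identityˡ []      = refl
·-identityˡ (c ∷ p) = cong₂ _∷_ (ℤ.*-identityˡ c) (·-identityˡ p)

·-zeroˡ : ∀ p → (+ 0) ·ₚ p ≈ []
·-zeroˡ p = coeffwise (coeff-map (+ 0 ℤ.*_) refl p)

·-shift : ∀ a p → a ·ₚ shift p ≡ shift (a ·ₚ p)
·-shift a p = cong (_∷ a ·ₚ p) (ℤ.*-zeroʳ a)

*-zeroˡ : ∀ {p} r → [] ≈ p → [] ≈ p *ₚ r
*-zeroˡ {[]}    r []≈p = ≈-refl
*-zeroˡ {d ∷ p} r []≈d∷p with []≈∷-inverse []≈d∷p
... | refl , []≈p = ≈-trans []≈shift[]
  (≈-trans (shift-cong (*-zeroˡ r []≈p)) (≈-sym (+-congʳ (shift (p *ₚ r)) (·-zeroˡ r))))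

*-zeroʳ : ∀ p → [] ≈ p *ₚ []
*-zeroʳ []      = ≈-refl
*-zeroʳ (c ∷ p) = ≈-trans []≈shift[] (shift-cong (*-zeroʳ p))

*-congʳ : ∀ {p p′} r → p ≈ p′ → p *ₚ r ≈ p′ *ₚ r
*-congʳ {[]}    r p≈p′ = *-zeroˡ r p≈p′
*-congʳ {c ∷ p} {[]}     r p≈p′ = ≈-sym (*-zeroˡ r (≈-sym p≈p′))
*-congʳ {c ∷ p} {d ∷ p′} r c∷p≈d∷p′ with ∷-injective c∷p≈d∷p′
... | refl , p≈p′ = +-congˡ (c ·ₚ r) (shift-cong (*-congʳ r p≈p′))

*-congˡ : ∀ p {r r′} → r ≈ r′ → p *ₚ r ≈ p *ₚ r′
*-congˡ []      r≈r′ = ≈-refl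
*-congˡ (c ∷ p) r≈r′ = +-cong (·-cong c r≈r′) (shift-cong (*-congˡ p r≈r′))

*-cong : ∀ {p p′ r r′} → p ≈ p′ → r ≈ r′ → p *ₚ r ≈ p′ *ₚ r′
*-cong {p′ = p′} {r} p≈p′ r≈r′ = ≈-trans (*-congʳ r p≈p′) (*-congˡ p′ r≈r′)

*-distribʳ : ∀ p p′ r → (p +ₚ p′) *ₚ r ≡ p *ₚ r +ₚ p′ *ₚ r
*-distribʳ []      p′       r = refl
*-distribʳ (c ∷ p) []       r = sym (+-identityʳ _)
*-distribʳ (c ∷ p) (d ∷ p′) r = begin
  (c ℤ.+ d) ·ₚ r +ₚ shift ((p +ₚ p′) *ₚ r)
    ≡⟨ cong₂ (λ u v → u +ₚ shift v) (·-distribʳ c d r) (*-distribʳ p p′ r) ⟩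
  (c ·ₚ r +ₚ d ·ₚ r) +ₚ (shift (p *ₚ r) +ₚ shift (p′ *ₚ r))
    ≡⟨ +-interchange (c ·ₚ r) (d ·ₚ r) (shift (p *ₚ r)) (shift (p′ *ₚ r)) ⟩
  (c ·ₚ r +ₚ shift (p *ₚ r)) +ₚ (d ·ₚ r +ₚ shift (p′ *ₚ r))
    ∎
  where open ≡-Reasoning

*-distribˡ : ∀ r p p′ → r *ₚ (p +ₚ p′) ≡ r *ₚ p +ₚ r *ₚ p′
*-distribˡ []      p p′ = refl
*-distribˡ (c ∷ r) p p′ = begin
  c ·ₚ (p +ₚ p′) +ₚ shift (r *ₚ (p +ₚ p′))
    ≡⟨ cong₂ (λ u v → u +ₚ shift v) (·-distribˡ c p p′) (*-distribˡ r p p′) ⟩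
  (c ·ₚ p +ₚ c ·ₚ p′) +ₚ (shift (r *ₚ p) +ₚ shift (r *ₚ p′))
    ≡⟨ +-interchange (c ·ₚ p) (c ·ₚ p′) (shift (r *ₚ p)) (shift (r *ₚ p′)) ⟩
  (c ·ₚ p +ₚ shift (r *ₚ p)) +ₚ (c ·ₚ p′ +ₚ shift (r *ₚ p′))
    ∎
  where open ≡-Reasoning

*-shiftʳ : ∀ p r → p *ₚ shift r ≈ shift (p *ₚ r)
*-shiftʳ []      r = []≈shift[]
*-shiftʳ (c ∷ p) r = +-cong (≡⇒≈ (·-shift c r)) (shift-cong (*-shiftʳ p r))

*-shiftˡ : ∀ p r → shift p *ₚ r ≈ shift (p *ₚ r)
*-shiftˡ p r = +-congʳ (shift (p *ₚ r)) (·-zeroˡ r)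

*-constʳ : ∀ r c → r *ₚ constₚ c ≈ c ·ₚ r
*-constʳ []      c = ≈-refl
*-constʳ (d ∷ r) c = ∷-cong (trans (ℤ.+-identityʳ _) (ℤ.*-comm d c)) (*-constʳ r c)

*-comm : ∀ p r → p *ₚ r ≈ r *ₚ p
*-comm []      r = *-zeroʳ r
*-comm (c ∷ p) r = begin
  c ·ₚ r +ₚ shift (p *ₚ r)         ≈⟨ +-cong (≈-sym (*-constʳ r c)) (shift-cong (*-comm p r)) ⟩
  r *ₚ constₚ c +ₚ shift (r *ₚ p)  ≈⟨ +-congˡ (r *ₚ constₚ c) (*-shiftʳ r p) ⟨
  r *ₚ constₚ c +ₚ r *ₚ shift p    ≈⟨ ≡⇒≈ (*-distribˡ r (constₚ c) (shift p)) ⟨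
  r *ₚ (constₚ c +ₚ shift p)       ≈⟨ *-congˡ r (∷-cong (ℤ.+-identityʳ c) ≈-refl) ⟩
  r *ₚ (c ∷ p)                     ∎
  where open ≈-Reasoning

·-*-assoc : ∀ a p r → (a ·ₚ p) *ₚ r ≈ a ·ₚ (p *ₚ r)
·-*-assoc a []      r = ≈-refl
·-*-assoc a (c ∷ p) r = begin
  (a ℤ.* c) ·ₚ r +ₚ shift ((a ·ₚ p) *ₚ r)
    ≈⟨ +-cong (≡⇒≈ (sym (·-assoc a c r))) (shift-cong (·-*-assoc a p r)) ⟩
  a ·ₚ (c ·ₚ r) +ₚ shift (a ·ₚ (p *ₚ r))
    ≈⟨ ≡⇒≈ (cong (a ·ₚ (c ·ₚ r) +ₚ_) (·-shift a (p *ₚ r))) ⟨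
  a ·ₚ (c ·ₚ r) +ₚ a ·ₚ shift (p *ₚ r)
    ≈⟨ ≡⇒≈ (·-distribˡ a (c ·ₚ r) (shift (p *ₚ r))) ⟨
  a ·ₚ (c ·ₚ r +ₚ shift (p *ₚ r))
    ∎
  where open ≈-Reasoning

*-assoc : ∀ p r s → (p *ₚ r) *ₚ s ≈ p *ₚ (r *ₚ s)
*-assoc []      r s = ≈-refl
*-assoc (c ∷ p) r s = begin
  (c ·ₚ r +ₚ shift (p *ₚ r)) *ₚ s         ≈⟨ ≡⇒≈ (*-distribʳ (c ·ₚ r) (shift (p *ₚ r)) s) ⟩
  (c ·ₚ r) *ₚ s +ₚ shift (p *ₚ r) *ₚ s    ≈⟨ +-cong (·-*-assoc c r s) (*-shiftˡ (p *ₚ r) s) ⟩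
  c ·ₚ (r *ₚ s) +ₚ shift ((p *ₚ r) *ₚ s)  ≈⟨ +-congˡ (c ·ₚ (r *ₚ s)) (shift-cong (*-assoc p r s)) ⟩
  c ·ₚ (r *ₚ s) +ₚ shift (p *ₚ (r *ₚ s))  ∎
  where open ≈-Reasoning

*-identityˡ : ∀ p → oneₚ *ₚ p ≈ p
*-identityˡ p = ≈-trans (+-cong (≡⇒≈ (·-identityˡ p)) (≈-sym []≈shift[])) (≡⇒≈ (+-identityʳ p))

*-identityʳ : ∀ p → p *ₚ oneₚ ≈ p
*-identityʳ p = ≈-trans (*-comm p oneₚ) (*-identityˡ p)

polyRing : CommutativeRing _ _
polyRing = record
  { Carrier           = Poly
  ; _≈_               = _≈_
  ; _+_               = _+ₚ_
  ; _*_               = _*ₚ_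
  ; -_                = -ₚ_
  ; 0#                = []
  ; 1#                = oneₚ
  ; isCommutativeRing = record
    { isRing = record
      { +-isAbelianGroup = record
        { isGroup = record
          { isMonoid = record
            { isSemigroup = record
              { isMagma = record { isEquivalence = Setoid.isEquivalence ≈-setoid ; ∙-cong = +-cong }
              ; assoc   = λ p r s → ≡⇒≈ (+-assoc p r s)
              }
            ; identity = (λ _ → ≈-refl) , ≡⇒≈ ∘ +-identityʳ
            }
          ; inverse = -‿inverseˡ , -‿inverseʳ
          ; ⁻¹-cong = -‿cong
          }
        ; comm = λ p r → ≡⇒≈ (+-comm p r)
        }
      ; *-cong     = *-cong
      ; *-assoc    = *-assoc
      ; *-identity = *-identityˡ , *-identityʳ
      ; distrib    = (λ r p p′ → ≡⇒≈ (*-distribˡ r p p′)) , (λ r p p′ → ≡⇒≈ (*-distribʳ p p′ r))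
      }
    ; *-comm = *-comm
    }
  }

zero? : ∀ p → Maybe ([] ≈ p)
zero? []      = just ≈-refl
zero? (c ∷ p) with + 0 ℤ.≟ c | zero? p
... | yes 0≡c | just []≈p = just ([]≈∷ 0≡c []≈p)
... | _       | _         = nothing

polyACR : ACR.AlmostCommutativeRing _ _
polyACR = ACR.fromCommutativeRing polyRing zero?

-- Geometric sums, signs and weights

X : Poly
X = X^ 1

shift≈X* : ∀ p → shift p ≈ X *ₚ p
shift≈X* p = ≈-sym (+-cong (·-zeroˡ p) (shift-cong (*-identityˡ p)))

sum-map-shift : ∀ ps → sumₚ (List.map shift ps) ≈ shift (sumₚ ps)
sum-map-shift []       = []≈shift[]
sum-map-shift (p ∷ ps) = +-congˡ (shift p) (sum-map-shift ps)

geometric : ℕ → Poly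
geometric k = sumₚ (List.map X^ (List.upTo k))

geometric-suc-rangeSum : ∀ k → geometric (suc k) ≡ oneₚ +ₚ rangeSum 1 k
geometric-suc-rangeSum k = cong (λ ps → oneₚ +ₚ sumₚ ps)
  (trans (map-applyUpTo suc X^ k) (sym (map-applyUpTo id (X^ ∘ suc) k)))

rangeSum-1 : ∀ k → rangeSum 1 k ≈ X *ₚ geometric k
rangeSum-1 k = begin
  sumₚ (List.map (shift ∘ X^) (List.upTo k))        ≡⟨ cong sumₚ (map-∘ (List.upTo k)) ⟩
  sumₚ (List.map shift (List.map X^ (List.upTo k))) ≈⟨ sum-map-shift (List.map X^ (List.upTo k)) ⟩
  shift (geometric k)                               ≈⟨ shift≈X* (geometric k) ⟩
  X *ₚ geometric k                                  ∎
  where open ≈-Reasoning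

geometric-suc : ∀ k → geometric (suc k) ≈ oneₚ +ₚ X *ₚ geometric k
geometric-suc k = ≈-trans (≡⇒≈ (geometric-suc-rangeSum k)) (+-congˡ oneₚ (rangeSum-1 k))

geometric-recurrence : ∀ k →
  geometric (2 ℕ.+ k) ≈ geometric (suc k) +ₚ X *ₚ (geometric (suc k) +ₚ -ₚ geometric k)
geometric-recurrence k = begin
  geometric (2 ℕ.+ k)                         ≈⟨ geometric-suc (suc k) ⟩
  oneₚ +ₚ X *ₚ geometric (suc k)              ≈⟨ +-congˡ oneₚ (*-congˡ X (geometric-suc k)) ⟩
  oneₚ +ₚ X *ₚ (oneₚ +ₚ X *ₚ g)               ≈⟨ identity X g ⟩
  g₁ +ₚ X *ₚ (g₁ +ₚ -ₚ g)                     ≈⟨ +-cong g₁≈ (*-congˡ X (+-congʳ (-ₚ g) g₁≈)) ⟩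
  geometric (suc k) +ₚ X *ₚ (geometric (suc k) +ₚ -ₚ g) ∎
  where
  open ≈-Reasoning
  g = geometric k
  g₁ = oneₚ +ₚ X *ₚ g
  g₁≈ : g₁ ≈ geometric (suc k)
  g₁≈ = ≈-sym (geometric-suc k)
  identity : ∀ x g → let g₁ = oneₚ +ₚ x *ₚ g in oneₚ +ₚ x *ₚ g₁ ≈ g₁ +ₚ x *ₚ (g₁ +ₚ -ₚ g)
  identity = solve-∀ polyACR

weight : ℕ → ℕ → Poly
weight zero    k = oneₚ +ₚ -ₚ geometric k
weight (suc _) k = geometric k

weights : ∀ {n} → Vec ℕ n → Vec ℕ n → Poly
weights ℓs ks = prodVecₚ (Vec.zipWith weight ℓs ks)

rangeFactor : ℕ → ℕ → Poly
rangeFactor ℓ k = rangeSum (1 ∸ ℓ) (k ∸ 1)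

constₚ-* : ∀ a b → constₚ (a ℤ.* b) ≈ constₚ a *ₚ constₚ b
constₚ-* a b = ∷-cong (sym (ℤ.+-identityʳ _)) ≈-refl

signₚ-+ : ∀ m n → signₚ (m ℕ.+ n) ≈ signₚ m *ₚ signₚ n
signₚ-+ m n = ≈-trans (≡⇒≈ (cong constₚ (ℤ.^-distribˡ-+-* -[1+ 0 ] m n)))
                      (constₚ-* (-[1+ 0 ] ℤ.^ m) (-[1+ 0 ] ℤ.^ n))

signed-rangeFactor : ∀ {ℓ} k → ℓ ≤ 1 → 1 ≤ k → signₚ (suc ℓ) *ₚ rangeFactor ℓ k ≈ weight ℓ k
signed-rangeFactor (suc k) (s≤s z≤n) _ = *-identityˡ (geometric (suc k))
signed-rangeFactor (suc k) z≤n       _ = begin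
  -ₚ oneₚ *ₚ rangeSum 1 k                  ≈⟨ *-congˡ (-ₚ oneₚ) (rangeSum-1 k) ⟩
  -ₚ oneₚ *ₚ (X *ₚ geometric k)            ≈⟨ identity (X *ₚ geometric k) ⟩
  oneₚ +ₚ -ₚ (oneₚ +ₚ X *ₚ geometric k)    ≈⟨ +-congˡ oneₚ (-‿cong (geometric-suc k)) ⟨
  oneₚ +ₚ -ₚ geometric (suc k)             ∎
  where
  open ≈-Reasoning
  identity : ∀ p → -ₚ oneₚ *ₚ p ≈ oneₚ +ₚ -ₚ (oneₚ +ₚ p)
  identity = solve-∀ polyACR

signed-product : ∀ {n} (ℓs ks : Vec ℕ n) → All (_≤ 1) ℓs → (∀ i → 1 ≤ lookup ks i) →
                 signₚ (n ℕ.+ sum ℓs) *ₚ prodVecₚ (Vec.zipWith rangeFactor ℓs ks) ≈ weights ℓs ks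
signed-product []       []       []           _    = *-identityˡ oneₚ
signed-product {suc n} (ℓ ∷ ℓs) (k ∷ ks) (ℓ≤1 ∷ ℓs≤1) 1≤ks = begin
  signₚ (suc n ℕ.+ (ℓ ℕ.+ sum ℓs)) *ₚ (r *ₚ rs)  ≡⟨ cong (λ e → signₚ e *ₚ (r *ₚ rs)) (regroup n ℓ _) ⟩
  signₚ (suc ℓ ℕ.+ (n ℕ.+ sum ℓs)) *ₚ (r *ₚ rs)  ≈⟨ *-congʳ (r *ₚ rs) (signₚ-+ (suc ℓ) _) ⟩
  (σ *ₚ σs) *ₚ (r *ₚ rs)                         ≈⟨ interchange σ σs r rs ⟩
  (σ *ₚ r) *ₚ (σs *ₚ rs)                         ≈⟨ *-cong (signed-rangeFactor k ℓ≤1 (1≤ks zero))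
                                                           (signed-product ℓs ks ℓs≤1 (1≤ks ∘ suc)) ⟩
  weights (ℓ ∷ ℓs) (k ∷ ks)                      ∎
  where
  open ≈-Reasoning
  σ = signₚ (suc ℓ)
  σs = signₚ (n ℕ.+ sum ℓs)
  r = rangeFactor ℓ k
  rs = prodVecₚ (Vec.zipWith rangeFactor ℓs ks)
  regroup : ∀ n ℓ s → suc n ℕ.+ (ℓ ℕ.+ s) ≡ suc ℓ ℕ.+ (n ℕ.+ s)
  regroup = ℕ-Solver.solve-∀
  interchange : ∀ a b c d → (a *ₚ b) *ₚ (c *ₚ d) ≈ (a *ₚ c) *ₚ (b *ₚ d)
  interchange = solve-∀ polyACR

-- Sums over {0,1}ⁿ

Σᵇ : ∀ n → (Vec ℕ n → Poly) → Poly
Σᵇ n f = sumₚ (List.map f (binVecs n))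

sum-map-cong : ∀ {V : Set} (vs : List V) {f g : V → Poly} → (∀ v → f v ≈ g v) →
               sumₚ (List.map f vs) ≈ sumₚ (List.map g vs)
sum-map-cong []       f≈g = ≈-refl
sum-map-cong (v ∷ vs) f≈g = +-cong (f≈g v) (sum-map-cong vs f≈g)

sum-map-linear : ∀ {V : Set} (vs : List V) (a b : Poly) (f g : V → Poly) →
                 sumₚ (List.map (λ v → a *ₚ f v +ₚ b *ₚ g v) vs)
                   ≈ a *ₚ sumₚ (List.map f vs) +ₚ b *ₚ sumₚ (List.map g vs)
sum-map-linear []       a b f g = +-cong (*-zeroʳ a) (*-zeroʳ b)
sum-map-linear (v ∷ vs) a b f g =
  ≈-trans (+-congˡ (a *ₚ f v +ₚ b *ₚ g v) (sum-map-linear vs a b f g))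
          (identity a b (f v) (g v) (sumₚ (List.map f vs)) (sumₚ (List.map g vs)))
  where
  identity : ∀ a b x y s t →
             (a *ₚ x +ₚ b *ₚ y) +ₚ (a *ₚ s +ₚ b *ₚ t) ≈ a *ₚ (x +ₚ s) +ₚ b *ₚ (y +ₚ t)
  identity = solve-∀ polyACR

Σᵇ-suc : ∀ n (f : Vec ℕ (suc n) → Poly) → Σᵇ (suc n) f ≈ Σᵇ n (λ v → f (0 ∷ v) +ₚ f (1 ∷ v))
Σᵇ-suc n f = go (binVecs n)
  where
  go : ∀ vs → sumₚ (List.map f (List.concatMap (λ v → (0 ∷ v) ∷ (1 ∷ v) ∷ []) vs))
                ≈ sumₚ (List.map (λ v → f (0 ∷ v) +ₚ f (1 ∷ v)) vs)
  go []       = ≈-refl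
  go (v ∷ vs) = ≈-trans (+-congˡ (f (0 ∷ v)) (+-congˡ (f (1 ∷ v)) (go vs)))
                        (≡⇒≈ (sym (+-assoc (f (0 ∷ v)) (f (1 ∷ v)) _)))

Σᵇ-cong : ∀ n {f g : Vec ℕ n → Poly} → (∀ ℓs → All (_≤ 1) ℓs → f ℓs ≈ g ℓs) →
          Σᵇ n f ≈ Σᵇ n g
Σᵇ-cong zero    f≈g = +-congʳ [] (f≈g [] [])
Σᵇ-cong (suc n) {f} {g} f≈g = begin
  Σᵇ (suc n) f                          ≈⟨ Σᵇ-suc n f ⟩
  Σᵇ n (λ v → f (0 ∷ v) +ₚ f (1 ∷ v))   ≈⟨ Σᵇ-cong n (λ v v≤1 → +-cong (f≈g (0 ∷ v) (z≤n ∷ v≤1))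
                                                                       (f≈g (1 ∷ v) (s≤s z≤n ∷ v≤1))) ⟩
  Σᵇ n (λ v → g (0 ∷ v) +ₚ g (1 ∷ v))   ≈⟨ Σᵇ-suc n g ⟨
  Σᵇ (suc n) g                          ∎
  where open ≈-Reasoning

-- Reindexing and pivoting adjacency matrices

reindex : ∀ {m n} → (Fin m → Fin n) → Adj n → Adj m
reindex f A = tabulate λ i → tabulate λ j → adj A (f i) (f j)

adj-tabulate : ∀ {n} (F : Fin n → Fin n → Bool) i j → adj (tabulate λ i → tabulate (F i)) i j ≡ F i j
adj-tabulate F i j = trans (cong (λ row → lookup row j) (lookup∘tabulate (λ i → tabulate (F i)) i))
                           (lookup∘tabulate (F i) j)

adj-reindex : ∀ {m n} (f : Fin m → Fin n) A i j → adj (reindex f A) i j ≡ adj A (f i) (f j)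
adj-reindex f A = adj-tabulate λ i j → adj A (f i) (f j)

Adj-ext : ∀ {n} {A B : Adj n} → (∀ i j → adj A i j ≡ adj B i j) → A ≡ B
Adj-ext A≗B = Pointwise-≡⇒≡ (ext λ i → Pointwise-≡⇒≡ (ext (A≗B i)))

reindex-cong : ∀ {m n} {f g : Fin m → Fin n} → (∀ i → f i ≡ g i) → ∀ A → reindex f A ≡ reindex g A
reindex-cong f≗g A = Adj-ext λ i j →
  trans (adj-reindex _ A i j) (trans (cong₂ (adj A) (f≗g i) (f≗g j)) (sym (adj-reindex _ A i j)))

reindex-∘ : ∀ {l m n} (f : Fin l → Fin m) (g : Fin m → Fin n) A →
            reindex f (reindex g A) ≡ reindex (g ∘ f) A
reindex-∘ f g A = Adj-ext λ i j →
  trans (adj-reindex f (reindex g A) i j) (trans (adj-reindex g A (f i) (f j)) (sym (adj-reindex (g ∘ f) A i j)))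

delete-zero-delete-suc : ∀ {n} (a : Fin (suc n)) A → delete zero (delete (suc a) A) ≡ delete a (delete zero A)
delete-zero-delete-suc a A = trans (reindex-∘ suc (punchIn (suc a)) A) (sym (reindex-∘ (punchIn a) suc A))

Simple-reindex : ∀ {m n} (f : Fin m → Fin n) {A} → Simple A → Simple (reindex f A)
Simple-reindex f {A} simple = record
  { symmetric = λ i j → trans (adj-reindex f A i j) (trans (symmetric (f i) (f j)) (sym (adj-reindex f A j i)))
  ; loopless  = λ i → trans (adj-reindex f A i i) (loopless (f i))
  }
  where open Simple simple

adjacent⇒≢ : ∀ {n} {A : Adj n} → Simple A → ∀ {u v} → adj A u v ≡ true → u ≢ v
adjacent⇒≢ simple {u} uv refl with () ← trans (sym uv) (Simple.loopless simple u)

adj-edgeless : ∀ n i j → adj (edgeless n) i j ≡ false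
adj-edgeless n i j = trans (cong (λ row → lookup row j) (lookup-replicate i _)) (lookup-replicate j false)

reindex-edgeless : ∀ {m n} (f : Fin m → Fin n) → reindex f (edgeless n) ≡ edgeless m
reindex-edgeless {m} {n} f = Adj-ext λ i j →
  trans (adj-reindex f (edgeless n) i j) (trans (adj-edgeless n (f i) (f j)) (sym (adj-edgeless m i j)))

edgeless-or-edge : ∀ {n} (A : Adj n) → A ≡ edgeless n ⊎ ∃₂ λ a b → adj A a b ≡ true
edgeless-or-edge A with any? (λ a → any? (λ b → adj A a b ≟ᵇ true))
... | yes (a , b , ab) = inj₂ (a , b , ab)
... | no ∄edge = inj₁ (Adj-ext λ a b → trans (¬-not λ ab → ∄edge (a , b , ab)) (sym (adj-edgeless _ a b)))

isOther : ∀ {n} → Fin n → Fin n → Fin n → Bool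
isOther a b x = not ⌊ x ≟ a ⌋ ∧ not ⌊ x ≟ b ⌋

isOther-a : ∀ {n} (a b : Fin n) → isOther a b a ≡ false
isOther-a a b rewrite isYes≗does (a ≟ a) | dec-true (a ≟ a) refl = refl

isOther-other : ∀ {n} {a b x : Fin n} → x ≢ a → x ≢ b → isOther a b x ≡ true
isOther-other {a = a} {b} {x} x≢a x≢b
  rewrite isYes≗does (x ≟ a) | dec-false (x ≟ a) x≢a | isYes≗does (x ≟ b) | dec-false (x ≟ b) x≢b = refl

≟-injective : ∀ {m n} {f : Fin m → Fin n} → Injective _≡_ _≡_ f →
              ∀ x y → ⌊ f x ≟ f y ⌋ ≡ ⌊ x ≟ y ⌋
≟-injective {f = f} inj x y with f x ≟ f y | x ≟ y
... | yes _     | yes _    = refl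
... | no _      | no _     = refl
... | yes fx≡fy | no x≢y   = contradiction (inj fx≡fy) x≢y
... | no fx≢fy  | yes refl = contradiction refl fx≢fy

toggles : (ox xa xb oy ya yb : Bool) → Bool
toggles ox xa xb oy ya yb = (ox ∧ (xa ∨ xb)) ∧ (oy ∧ (ya ∨ yb)) ∧ not (not (xa xor ya) ∧ not (xb xor yb))

toggles-sym : ∀ ox xa xb oy ya yb → toggles ox xa xb oy ya yb ≡ toggles oy ya yb ox xa xb
toggles-sym ox xa xb oy ya yb = begin
  cx ∧ cy ∧ differ xa ya xb yb    ≡⟨ ∧-assoc cx cy _ ⟨
  (cx ∧ cy) ∧ differ xa ya xb yb  ≡⟨ cong₂ _∧_ (∧-comm cx cy) (cong₂ (λ u v → not (not u ∧ not v))
                                                                    (xor-comm xa ya) (xor-comm xb yb)) ⟩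
  (cy ∧ cx) ∧ differ ya xa yb xb  ≡⟨ ∧-assoc cy cx _ ⟩
  cy ∧ cx ∧ differ ya xa yb xb    ∎
  where
  open ≡-Reasoning
  cx = ox ∧ (xa ∨ xb)
  cy = oy ∧ (ya ∨ yb)
  differ : Bool → Bool → Bool → Bool → Bool
  differ xa ya xb yb = not (not (xa xor ya) ∧ not (xb xor yb))

toggles-diagonal : ∀ o xa xb → toggles o xa xb o xa xb ≡ false
toggles-diagonal o xa xb rewrite xor-same xa | xor-same xb =
  trans (cong ((o ∧ (xa ∨ xb)) ∧_) (∧-zeroʳ (o ∧ (xa ∨ xb)))) (∧-zeroʳ (o ∧ (xa ∨ xb)))

pivotEntry : ∀ {n} → (Fin n → Fin n → Bool) → (Fin n → Bool) → (a b x y : Fin n) → Bool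
pivotEntry E o a b x y = E x y xor toggles (o x) (E x a) (E x b) (o y) (E y a) (E y b)

adj-pivot : ∀ {n} (a b : Fin n) A x y → adj (pivot a b A) x y ≡ pivotEntry (adj A) (isOther a b) a b x y
adj-pivot a b A = adj-tabulate (pivotEntry (adj A) (isOther a b) a b)

pivotEntry-cong : ∀ {n} {E E′ : Fin n → Fin n → Bool} {o o′ : Fin n → Bool} →
                  (∀ u v → E u v ≡ E′ u v) → (∀ u → o u ≡ o′ u) →
                  ∀ a b x y → pivotEntry E o a b x y ≡ pivotEntry E′ o′ a b x y
pivotEntry-cong E≗E′ o≗o′ a b x y
  rewrite E≗E′ x y | E≗E′ x a | E≗E′ x b | E≗E′ y a | E≗E′ y b | o≗o′ x | o≗o′ y = refl

Simple-pivot : ∀ {n} (a b : Fin n) {A} → Simple A → Simple (pivot a b A)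
Simple-pivot a b {A} simple = record
  { symmetric = λ x y → trans (adj-pivot a b A x y) (trans (cong₂ _xor_ (symmetric x y)
      (toggles-sym (isOther a b x) (adj A x a) (adj A x b) (isOther a b y) (adj A y a) (adj A y b)))
      (sym (adj-pivot a b A y x)))
  ; loopless  = λ x → trans (adj-pivot a b A x x)
      (cong₂ _xor_ (loopless x) (toggles-diagonal (isOther a b x) (adj A x a) (adj A x b)))
  }
  where open Simple simple

reindex-pivot : ∀ {m n} {f : Fin m → Fin n} → Injective _≡_ _≡_ f → ∀ a b A →
                reindex f (pivot (f a) (f b) A) ≡ pivot a b (reindex f A)
reindex-pivot {f = f} inj a b A = Adj-ext λ x y → begin
  adj (reindex f (pivot (f a) (f b) A)) x y
    ≡⟨ adj-reindex f (pivot (f a) (f b) A) x y ⟩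
  adj (pivot (f a) (f b) A) (f x) (f y)
    ≡⟨ adj-pivot (f a) (f b) A (f x) (f y) ⟩
  pivotEntry (λ u v → adj A (f u) (f v)) (isOther (f a) (f b) ∘ f) a b x y
    ≡⟨ pivotEntry-cong (λ u v → sym (adj-reindex f A u v)) isOther-f a b x y ⟩
  pivotEntry (adj (reindex f A)) (isOther a b) a b x y
    ≡⟨ adj-pivot a b (reindex f A) x y ⟨
  adj (pivot a b (reindex f A)) x y
    ∎
  where
  open ≡-Reasoning
  isOther-f : ∀ u → isOther (f a) (f b) (f u) ≡ isOther a b u
  isOther-f u = cong₂ (λ s t → not s ∧ not t) (≟-injective inj u a) (≟-injective inj u b)

module _ {m n} (π : Permutation (suc m) (suc n)) where

  private
    πʳ = π ⟨$⟩ʳ_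
    πˡ = π ⟨$⟩ˡ_

  delete-permute : ∀ a A → delete (πˡ a) (reindex πʳ A) ≡ reindex (remove (πˡ a) π ⟨$⟩ʳ_) (delete a A)
  delete-permute a A = begin
    reindex (punchIn (πˡ a)) (reindex πʳ A)   ≡⟨ reindex-∘ (punchIn (πˡ a)) πʳ A ⟩
    reindex (πʳ ∘ punchIn (πˡ a)) A           ≡⟨ reindex-cong (punchIn-permute′ π a) A ⟩
    reindex (punchIn a ∘ ρʳ) A                ≡⟨ reindex-∘ ρʳ (punchIn a) A ⟨
    reindex ρʳ (reindex (punchIn a) A)        ∎
    where
    open ≡-Reasoning
    ρʳ = remove (πˡ a) π ⟨$⟩ʳ_

  pivot-permute : ∀ a b A → pivot (πˡ a) (πˡ b) (reindex πʳ A) ≡ reindex πʳ (pivot a b A)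
  pivot-permute a b A = begin
    pivot (πˡ a) (πˡ b) (reindex πʳ A)
      ≡⟨ reindex-pivot (Injection.injective (↔⇒↣ π)) (πˡ a) (πˡ b) A ⟨
    reindex πʳ (pivot (πʳ (πˡ a)) (πʳ (πˡ b)) A)
      ≡⟨ cong₂ (λ u v → reindex πʳ (pivot u v A)) (inverseʳ π) (inverseʳ π) ⟩
    reindex πʳ (pivot a b A)
      ∎
    where open ≡-Reasoning

pivot-isolated : ∀ {n} (a b : Fin n) {A v} → (∀ y → adj A v y ≡ false) →
                 ∀ y → adj (pivot a b A) v y ≡ false
pivot-isolated a b {A} {v} v-isolated y
  rewrite adj-pivot a b A v y | v-isolated y | v-isolated a | v-isolated b | ∧-zeroʳ (isOther a b v) = refl

twin-toggle : ∀ ya yb → ya xor toggles true false true true ya yb ≡ false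
twin-toggle false false = refl
twin-toggle false true  = refl
twin-toggle true  false = refl
twin-toggle true  true  = refl

-- The twin a′ of a lies in class (2), and its neighbours other than b, being those of a, are
-- exactly the vertices of classes (1) and (3): the pivot toggles all of these edges.
pivot-twin : ∀ {n} {A : Adj n} → Simple A → ∀ {a a′ b} → a′ ≢ a →
             (∀ y → adj A a′ y ≡ adj A a y) → adj A a b ≡ true →
             ∀ y → y ≢ b → adj (pivot a b A) a′ y ≡ false
pivot-twin {A = A} simple {a} {a′} {b} a′≢a twins ab y y≢b with y ≟ a | y ≟ a′
... | yes refl | _
  rewrite adj-pivot a b A a′ a | isOther-a a b | trans (twins a) (Simple.loopless simple a) = ∧-zeroʳ _
... | no _     | yes refl = Simple.loopless (Simple-pivot a b simple) a′
... | no y≢a   | no y≢a′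
  rewrite adj-pivot a b A a′ y | isOther-other a′≢a (adjacent⇒≢ simple (trans (twins b) ab))
        | isOther-other y≢a y≢b | trans (twins a) (Simple.loopless simple a) | trans (twins b) ab
        | twins y | Simple.symmetric simple a y
  = twin-toggle (adj A y a) (adj A y b)

-- Blocks of copies in a blow-up

blocks : ∀ {m n} → (Fin n → Fin m) → Vec ℕ n → List (Fin m)
blocks c []       = []
blocks c (k ∷ ks) = List.replicate k (c zero) ++ blocks (c ∘ suc) ks

length-blocks : ∀ {m n} (c : Fin n → Fin m) ks → sum ks ≡ List.length (blocks c ks)
length-blocks c []       = refl
length-blocks c (k ∷ ks) = begin
  k ℕ.+ sum ks                                          ≡⟨ cong₂ ℕ._+_ (sym (length-replicate k))
                                                                       (length-blocks (c ∘ suc) ks) ⟩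
  List.length xs ℕ.+ List.length (blocks (c ∘ suc) ks)  ≡⟨ length-++ xs ⟨
  List.length (blocks c (k ∷ ks))                       ∎
  where
  open ≡-Reasoning
  xs = List.replicate k (c zero)

owner-suc : ∀ {n} k (ks : Vec ℕ n) i → owner (suc k ∷ ks) (suc i) ≡ owner (k ∷ ks) i
owner-suc k ks i with Fin.splitAt k i
... | inj₁ _ = refl
... | inj₂ _ = refl

lookup-blocks : ∀ {m n} (c : Fin n → Fin m) ks i →
                List.lookup (blocks c ks) (Fin.cast (length-blocks c ks) i) ≡ c (owner ks i)
lookup-blocks c (k ∷ ks) = go k
  where
  go : ∀ k i → List.lookup (blocks c (k ∷ ks)) (Fin.cast (length-blocks c (k ∷ ks)) i) ≡ c (owner (k ∷ ks) i)
  go zero    i       = lookup-blocks (c ∘ suc) ks i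
  go (suc k) zero    = refl
  go (suc k) (suc i) = trans (go k i) (cong c (sym (owner-suc k ks i)))

-- The interlace polynomial: invariance, isolated vertices and twins

module Interlace (q : (n : ℕ) → Adj n → Poly) (isInterlace : IsInterlace q) where

  open IsInterlace isInterlace

  q-edge : ∀ {m} (A : Adj (suc m)) → Simple A → ∀ a b → adj A a b ≡ true →
           q (suc m) A ≈ q m (delete a A) +ₚ q m (delete b (pivot a b A))
  q-edge A simple a b ab = coeffwise (edge-rule _ A simple a b ab)

  q-edgeless : ∀ n → q n (edgeless n) ≈ X^ n
  q-edgeless n = coeffwise (edgeless-rule n)

  q-cong : ∀ {n} {A B : Adj n} → A ≡ B → q n A ≈ q n B
  q-cong A≡B = ≡⇒≈ (cong (q _) A≡B)

  q-permute : ∀ {m n} (π : Permutation m n) A → Simple A → q m (reindex (π ⟨$⟩ʳ_) A) ≈ q n A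
  q-permute {m} {n} π A simple with edgeless-or-edge A
  ... | inj₁ refl = begin
    q m (reindex (π ⟨$⟩ʳ_) (edgeless n))  ≈⟨ q-cong (reindex-edgeless (π ⟨$⟩ʳ_)) ⟩
    q m (edgeless m)                      ≈⟨ q-edgeless m ⟩
    X^ m                                  ≡⟨ cong X^ (↔⇒≡ π) ⟩
    X^ n                                  ≈⟨ q-edgeless n ⟨
    q n (edgeless n)                      ∎
    where open ≈-Reasoning
  q-permute {zero}  {suc n} π A simple | inj₂ (a , _) with () ← π ⟨$⟩ˡ a
  q-permute {suc m} {suc n} π A simple | inj₂ (a , b , ab) = begin
    q (suc m) (reindex πʳ A)
      ≈⟨ q-edge (reindex πʳ A) (Simple-reindex πʳ simple) (πˡ a) (πˡ b) πˡa-πˡb ⟩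
    q m (delete (πˡ a) (reindex πʳ A)) +ₚ q m (delete (πˡ b) (pivot (πˡ a) (πˡ b) (reindex πʳ A)))
      ≈⟨ +-cong (q-cong (delete-permute π a A))
                (q-cong (trans (cong (delete (πˡ b)) (pivot-permute π a b A)) (delete-permute π b (pivot a b A)))) ⟩
    q m (reindex (remove (πˡ a) π ⟨$⟩ʳ_) (delete a A))
      +ₚ q m (reindex (remove (πˡ b) π ⟨$⟩ʳ_) (delete b (pivot a b A)))
      ≈⟨ +-cong (q-permute (remove (πˡ a) π) (delete a A) (Simple-reindex (punchIn a) simple))
                (q-permute (remove (πˡ b) π) (delete b (pivot a b A))
                           (Simple-reindex (punchIn b) (Simple-pivot a b simple))) ⟩
    q n (delete a A) +ₚ q n (delete b (pivot a b A))
      ≈⟨ q-edge A simple a b ab ⟨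
    q (suc n) A
      ∎
    where
    open ≈-Reasoning
    πʳ = π ⟨$⟩ʳ_
    πˡ = π ⟨$⟩ˡ_
    πˡa-πˡb : adj (reindex πʳ A) (πˡ a) (πˡ b) ≡ true
    πˡa-πˡb = trans (adj-reindex πʳ A (πˡ a) (πˡ b)) (trans (cong₂ (adj A) (inverseʳ π) (inverseʳ π)) ab)

  q-isolated : ∀ {m} (A : Adj (suc m)) → Simple A → (∀ j → adj A zero j ≡ false) →
               q (suc m) A ≈ X *ₚ q m (delete zero A)
  q-isolated {m} A simple 0-isolated with edgeless-or-edge (delete zero A)
  ... | inj₁ A₀≡edgeless = begin
    q (suc m) A                   ≈⟨ q-cong A≡edgeless ⟩
    q (suc m) (edgeless (suc m))  ≈⟨ q-edgeless (suc m) ⟩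
    shift (X^ m)                  ≈⟨ shift≈X* (X^ m) ⟩
    X *ₚ X^ m                     ≈⟨ *-congˡ X (q-edgeless m) ⟨
    X *ₚ q m (edgeless m)         ≈⟨ *-congˡ X (q-cong A₀≡edgeless) ⟨
    X *ₚ q m (delete zero A)      ∎
    where
    open ≈-Reasoning
    no-edge : ∀ i j → adj A i j ≡ false
    no-edge zero    j       = 0-isolated j
    no-edge (suc i) zero    = trans (Simple.symmetric simple (suc i) zero) (0-isolated (suc i))
    no-edge (suc i) (suc j) = trans (sym (adj-reindex suc A i j))
                                    (trans (cong (λ B → adj B i j) A₀≡edgeless) (adj-edgeless m i j))
    A≡edgeless : A ≡ edgeless (suc m)
    A≡edgeless = Adj-ext λ i j → trans (no-edge i j) (sym (adj-edgeless (suc m) i j))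
  q-isolated {suc m} A simple 0-isolated | inj₂ (a , b , ab) = begin
    q (2 ℕ.+ m) A
      ≈⟨ q-edge A simple (suc a) (suc b) (trans (sym (adj-reindex suc A a b)) ab) ⟩
    q (suc m) (delete (suc a) A) +ₚ q (suc m) (delete (suc b) P)
      ≈⟨ +-cong (q-isolated (delete (suc a) A) (Simple-reindex (punchIn (suc a)) simple) isolated₁)
                (q-isolated (delete (suc b) P) (Simple-reindex (punchIn (suc b)) (Simple-pivot (suc a) (suc b) simple))
                            isolated₂) ⟩
    X *ₚ q m (delete zero (delete (suc a) A)) +ₚ X *ₚ q m (delete zero (delete (suc b) P))
      ≈⟨ +-cong (*-congˡ X (q-cong (delete-zero-delete-suc a A)))
                (*-congˡ X (q-cong (trans (delete-zero-delete-suc b P)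
                                          (cong (delete b) (reindex-pivot suc-injective a b A))))) ⟩
    X *ₚ q m (delete a A₀) +ₚ X *ₚ q m (delete b (pivot a b A₀))
      ≈⟨ ≡⇒≈ (*-distribˡ X (q m (delete a A₀)) (q m (delete b (pivot a b A₀)))) ⟨
    X *ₚ (q m (delete a A₀) +ₚ q m (delete b (pivot a b A₀)))
      ≈⟨ *-congˡ X (q-edge A₀ (Simple-reindex suc simple) a b ab) ⟨
    X *ₚ q (suc m) A₀
      ∎
    where
    open ≈-Reasoning
    A₀ = delete zero A
    P = pivot (suc a) (suc b) A
    isolated₁ : ∀ j → adj (delete (suc a) A) zero j ≡ false
    isolated₁ j = trans (adj-reindex (punchIn (suc a)) A zero j) (0-isolated _)
    isolated₂ : ∀ j → adj (delete (suc b) P) zero j ≡ false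
    isolated₂ j = trans (adj-reindex (punchIn (suc b)) P zero j)
                        (pivot-isolated (suc a) (suc b) {A} 0-isolated (punchIn (suc b) j))

  module InducedSubgraphs {m} (A : Adj m) (simple : Simple A) where

    induced : (L : List (Fin m)) → Adj (List.length L)
    induced L = reindex (List.lookup L) A

    Q : List (Fin m) → Poly
    Q L = q (List.length L) (induced L)

    adj-induced : ∀ L i j → adj (induced L) i j ≡ adj A (List.lookup L i) (List.lookup L j)
    adj-induced L = adj-reindex (List.lookup L) A

    Simple-induced : ∀ L → Simple (induced L)
    Simple-induced L = Simple-reindex (List.lookup L) simple

    Q-≡ : ∀ {L L′} → L ≡ L′ → Q L ≈ Q L′
    Q-≡ L≡L′ = ≡⇒≈ (cong Q L≡L′)

    Q-↭ : ∀ {L L′} → L ↭ L′ → Q L ≈ Q L′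
    Q-↭ {L} {L′} L↭L′ = begin
      q _ (reindex (List.lookup L) A)        ≈⟨ q-cong (reindex-cong (onIndices-lookup L↭ₛL′) A) ⟩
      q _ (reindex (List.lookup L′ ∘ πʳ) A)  ≈⟨ q-cong (reindex-∘ πʳ (List.lookup L′) A) ⟨
      q _ (reindex πʳ (induced L′))          ≈⟨ q-permute π (induced L′) (Simple-induced L′) ⟩
      Q L′                                  ∎
      where
      open ≈-Reasoning
      open SetoidPermutation (≡-setoid (Fin m)) using (onIndices)
      open SetoidPermutationProperties (≡-setoid (Fin m)) using (onIndices-lookup)
      L↭ₛL′ = ↭⇒↭ₛ L↭L′
      π = onIndices L↭ₛL′
      πʳ = π ⟨$⟩ʳ_

    delete-zero-induced : ∀ x L → delete zero (induced (x ∷ L)) ≡ induced L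
    delete-zero-induced x L = reindex-∘ suc (List.lookup (x ∷ L)) A

    delete-one-induced : ∀ x L → delete (suc zero) (induced (x ∷ x ∷ L)) ≡ induced (x ∷ L)
    delete-one-induced x L = trans (reindex-∘ (punchIn (suc zero)) (List.lookup (x ∷ x ∷ L)) A)
      (reindex-cong {f = List.lookup (x ∷ x ∷ L) ∘ punchIn (suc zero)} {g = List.lookup (x ∷ L)}
                    (λ { zero → refl ; (suc i) → refl }) A)

    Q-isolated-head : ∀ x L → (∀ j → adj A x (List.lookup L j) ≡ false) → Q (x ∷ L) ≈ X *ₚ Q L
    Q-isolated-head x L x-isolated =
      ≈-trans (q-isolated (induced (x ∷ L)) (Simple-induced (x ∷ L)) isolated)
              (*-congˡ X (q-cong (delete-zero-induced x L)))
      where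
      isolated : ∀ j → adj (induced (x ∷ L)) zero j ≡ false
      isolated zero    = trans (adj-induced (x ∷ L) zero zero) (Simple.loopless simple x)
      isolated (suc j) = trans (adj-induced (x ∷ L) zero (suc j)) (x-isolated j)

    Q-twin-isolated : ∀ x T → (∀ j → adj A x (List.lookup T j) ≡ false) →
                      Q (x ∷ x ∷ T) ≈ Q (x ∷ T) +ₚ X *ₚ (Q (x ∷ T) +ₚ -ₚ Q T)
    Q-twin-isolated x T x-isolated = begin
      Q (x ∷ x ∷ T)                            ≈⟨ Q-isolated-head x (x ∷ T) x-isolated′ ⟩
      X *ₚ Q (x ∷ T)                           ≈⟨ *-congˡ X Q₁≈XQ₀ ⟩
      X *ₚ (X *ₚ Q T)                          ≈⟨ identity X (Q T) ⟩
      X *ₚ Q T +ₚ X *ₚ (X *ₚ Q T +ₚ -ₚ Q T)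
        ≈⟨ +-cong Q₁≈XQ₀ (*-congˡ X (+-congʳ (-ₚ Q T) Q₁≈XQ₀)) ⟨
      Q (x ∷ T) +ₚ X *ₚ (Q (x ∷ T) +ₚ -ₚ Q T)  ∎
      where
      open ≈-Reasoning
      Q₁≈XQ₀ : Q (x ∷ T) ≈ X *ₚ Q T
      Q₁≈XQ₀ = Q-isolated-head x T x-isolated
      x-isolated′ : ∀ j → adj A x (List.lookup (x ∷ T) j) ≡ false
      x-isolated′ zero    = Simple.loopless simple x
      x-isolated′ (suc j) = x-isolated j
      identity : ∀ x q₀ → x *ₚ (x *ₚ q₀) ≈ x *ₚ q₀ +ₚ x *ₚ (x *ₚ q₀ +ₚ -ₚ q₀)
      identity = solve-∀ polyACR

    Q-twin-adjacent : ∀ x T j → adj A x (List.lookup T j) ≡ true →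
                      Q (x ∷ x ∷ T) ≈ Q (x ∷ T) +ₚ X *ₚ (Q (x ∷ T) +ₚ -ₚ Q T)
    Q-twin-adjacent x T j xTj = begin
      Q (x ∷ x ∷ T)
        ≈⟨ q-edge G (Simple-induced (x ∷ x ∷ T)) (suc zero) b 1b ⟩
      q _ (delete (suc zero) G) +ₚ q _ (delete b P)
        ≈⟨ +-cong (q-cong (delete-one-induced x T)) (q-isolated (delete b P) Simple-DP 0-isolated) ⟩
      Q (x ∷ T) +ₚ X *ₚ q _ (delete zero (delete b P))
        ≈⟨ +-congˡ (Q (x ∷ T)) (*-congˡ X (≈-trans (q-cong delete-delete-P) Y≈Q₁-Q₀)) ⟩
      Q (x ∷ T) +ₚ X *ₚ (Q (x ∷ T) +ₚ -ₚ Q T)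
        ∎
      where
      open ≈-Reasoning
      G  = induced (x ∷ x ∷ T)
      G₁ = induced (x ∷ T)
      b : Fin (2 ℕ.+ List.length T)
      b = suc (suc j)
      P = pivot (suc zero) b G
      Y = q (List.length T) (delete (suc j) (pivot zero (suc j) G₁))
      1b : adj G (suc zero) b ≡ true
      1b = trans (adj-induced (x ∷ x ∷ T) (suc zero) b) xTj
      Simple-DP : Simple (delete b P)
      Simple-DP = Simple-reindex (punchIn b) (Simple-pivot (suc zero) b (Simple-induced (x ∷ x ∷ T)))
      twins : ∀ y → adj G zero y ≡ adj G (suc zero) y
      twins y = trans (adj-induced (x ∷ x ∷ T) zero y) (sym (adj-induced (x ∷ x ∷ T) (suc zero) y))
      0-isolated : ∀ u → adj (delete b P) zero u ≡ false
      0-isolated u = trans (adj-reindex (punchIn b) P zero u)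
        (pivot-twin (Simple-induced (x ∷ x ∷ T)) {suc zero} {zero} (λ ()) twins 1b (punchIn b u) (punchInᵢ≢i b u))
      delete-delete-P : delete zero (delete b P) ≡ delete (suc j) (pivot zero (suc j) G₁)
      delete-delete-P = trans (delete-zero-delete-suc (suc j) P) (cong (delete (suc j))
        (trans (reindex-pivot suc-injective zero (suc j) G) (cong (pivot zero (suc j)) (delete-zero-induced x (x ∷ T)))))
      Q₁≈Q₀+Y : Q (x ∷ T) ≈ Q T +ₚ Y
      Q₁≈Q₀+Y = ≈-trans (q-edge G₁ (Simple-induced (x ∷ T)) zero (suc j) 0sj)
                        (+-congʳ Y (q-cong (delete-zero-induced x T)))
        where
        0sj : adj G₁ zero (suc j) ≡ true
        0sj = trans (adj-induced (x ∷ T) zero (suc j)) xTj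
      Y≈Q₁-Q₀ : Y ≈ Q (x ∷ T) +ₚ -ₚ Q T
      Y≈Q₁-Q₀ = ≈-trans (cancel (Q T) Y) (+-congʳ (-ₚ Q T) (≈-sym Q₁≈Q₀+Y))
        where
        cancel : ∀ q₀ y → y ≈ (q₀ +ₚ y) +ₚ -ₚ q₀
        cancel = solve-∀ polyACR

    Q-twin : ∀ x T → Q (x ∷ x ∷ T) ≈ Q (x ∷ T) +ₚ X *ₚ (Q (x ∷ T) +ₚ -ₚ Q T)
    Q-twin x T with any? (λ j → adj A x (List.lookup T j) ≟ᵇ true)
    ... | yes (j , xTj) = Q-twin-adjacent x T j xTj
    ... | no ∄j         = Q-twin-isolated x T λ j → ¬-not λ xTj → ∄j (j , xTj)

    Q-block : ∀ k x Y → Q (List.replicate k x ++ Y) ≈ weight 0 k *ₚ Q Y +ₚ weight 1 k *ₚ Q (x ∷ Y)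
    Q-block zero          x Y = k≡0 (Q Y) (Q (x ∷ Y))
      where
      k≡0 : ∀ p r → p ≈ (oneₚ +ₚ -ₚ []) *ₚ p +ₚ [] *ₚ r
      k≡0 = solve-∀ polyACR
    Q-block (suc zero)    x Y = k≡1 (Q Y) (Q (x ∷ Y))
      where
      k≡1 : ∀ p r → r ≈ (oneₚ +ₚ -ₚ oneₚ) *ₚ p +ₚ oneₚ *ₚ r
      k≡1 = solve-∀ polyACR
    Q-block (suc (suc k)) x Y = begin
      Q (x ∷ x ∷ T)
        ≈⟨ Q-twin x T ⟩
      Q (x ∷ T) +ₚ X *ₚ (Q (x ∷ T) +ₚ -ₚ Q T)
        ≈⟨ +-cong (Q-block (suc k) x Y) (*-congˡ X (+-cong (Q-block (suc k) x Y) (-‿cong (Q-block k x Y)))) ⟩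
      mix g₁ +ₚ X *ₚ (mix g₁ +ₚ -ₚ mix g₀)
        ≈⟨ mix-affine g₁ g₀ X (Q Y) (Q (x ∷ Y)) ⟩
      mix (g₁ +ₚ X *ₚ (g₁ +ₚ -ₚ g₀))
        ≈⟨ mix-cong (geometric-recurrence k) ⟨
      mix (geometric (2 ℕ.+ k))
        ∎
      where
      open ≈-Reasoning
      T = List.replicate k x ++ Y
      g₀ = geometric k
      g₁ = geometric (suc k)
      mix : Poly → Poly
      mix g = (oneₚ +ₚ -ₚ g) *ₚ Q Y +ₚ g *ₚ Q (x ∷ Y)
      mix-cong : ∀ {g g′} → g ≈ g′ → mix g ≈ mix g′
      mix-cong g≈g′ = +-cong (*-congʳ (Q Y) (+-congˡ oneₚ (-‿cong g≈g′))) (*-congʳ (Q (x ∷ Y)) g≈g′)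
      mix-affine : ∀ g₁ g₀ x p r →
        let mix′ = λ g → (oneₚ +ₚ -ₚ g) *ₚ p +ₚ g *ₚ r
        in mix′ g₁ +ₚ x *ₚ (mix′ g₁ +ₚ -ₚ mix′ g₀) ≈ mix′ (g₁ +ₚ x *ₚ (g₁ +ₚ -ₚ g₀))
      mix-affine = solve-∀ polyACR

    Q-expand : ∀ {n} P (c : Fin n → Fin m) ks →
               Q (P ++ blocks c ks) ≈ Σᵇ n (λ ℓs → weights ℓs ks *ₚ Q (P ++ blocks c ℓs))
    Q-expand P c []       = ≈-sym (≈-trans (≡⇒≈ (+-identityʳ _)) (*-identityˡ (Q (P ++ []))))
    Q-expand {suc n} P c (k ∷ ks) = begin
      Q (P ++ List.replicate k x ++ R)
        ≈⟨ Q-↭ (shifts P (List.replicate k x)) ⟩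
      Q (List.replicate k x ++ P ++ R)
        ≈⟨ Q-block k x (P ++ R) ⟩
      w₀ *ₚ Q (P ++ R) +ₚ w₁ *ₚ Q (x ∷ P ++ R)
        ≈⟨ +-congˡ (w₀ *ₚ Q (P ++ R)) (*-congˡ w₁ (Q-↭ (shifts P [ x ]))) ⟨
      w₀ *ₚ Q (P ++ R) +ₚ w₁ *ₚ Q (P ++ x ∷ R)
        ≈⟨ +-cong (*-congˡ w₀ (Q-expand P c′ ks))
                  (*-congˡ w₁ (≈-trans (Q-≡ (sym (++-assoc P [ x ] R))) (Q-expand (P ++ [ x ]) c′ ks))) ⟩
      w₀ *ₚ Σᵇ n F₀ +ₚ w₁ *ₚ Σᵇ n F₁
        ≈⟨ sum-map-linear (binVecs n) w₀ w₁ F₀ F₁ ⟨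
      Σᵇ n (λ v → w₀ *ₚ F₀ v +ₚ w₁ *ₚ F₁ v)
        ≈⟨ sum-map-cong (binVecs n) (λ v → +-cong (F≈F₀ v) (F≈F₁ v)) ⟨
      Σᵇ n (λ v → F (0 ∷ v) +ₚ F (1 ∷ v))
        ≈⟨ Σᵇ-suc n F ⟨
      Σᵇ (suc n) F
        ∎
      where
      open ≈-Reasoning
      x = c zero
      c′ = c ∘ suc
      R = blocks c′ ks
      w₀ = weight 0 k
      w₁ = weight 1 k
      F : Vec ℕ (suc n) → Poly
      F ℓs = weights ℓs (k ∷ ks) *ₚ Q (P ++ blocks c ℓs)
      F₀ F₁ : Vec ℕ n → Poly
      F₀ v = weights v ks *ₚ Q (P ++ blocks c′ v)
      F₁ v = weights v ks *ₚ Q ((P ++ x ∷ []) ++ blocks c′ v)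
      F≈F₀ : ∀ v → F (0 ∷ v) ≈ w₀ *ₚ F₀ v
      F≈F₀ v = *-assoc w₀ (weights v ks) (Q (P ++ blocks c′ v))
      F≈F₁ : ∀ v → F (1 ∷ v) ≈ w₁ *ₚ F₁ v
      F≈F₁ v = ≈-trans (*-assoc w₁ (weights v ks) (Q (P ++ x ∷ blocks c′ v)))
                       (*-congˡ w₁ (*-congˡ (weights v ks) (Q-≡ (sym (++-assoc P [ x ] (blocks c′ v))))))

    q-blowup : (ks : Vec ℕ m) → q (sum ks) (blowup A ks) ≈ Q (blocks id ks)
    q-blowup ks = begin
      q (sum ks) (reindex (owner ks) A)
        ≈⟨ q-cong (reindex-cong (λ i → sym (lookup-blocks id ks i)) A) ⟩
      q (sum ks) (reindex (List.lookup (blocks id ks) ∘ Fin.cast e) A)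
        ≈⟨ q-cong (reindex-∘ (Fin.cast e) (List.lookup (blocks id ks)) A) ⟨
      q (sum ks) (reindex (Fin.cast e) (induced (blocks id ks)))
        ≈⟨ q-permute (cast-id e) (induced (blocks id ks)) (Simple-induced (blocks id ks)) ⟩
      Q (blocks id ks)
        ∎
      where
      open ≈-Reasoning
      e = length-blocks id ks

proposition42 : (q : (n : ℕ) → Adj n → Poly) → IsInterlace q →
                ∀ n → 1 ≤ n → (A : Adj n) → Simple A →
                (ks : Vec ℕ n) → (∀ i → 1 ≤ lookup ks i) →
                q (sum ks) (blowup A ks) ≈ₚ qFormula q A ks
proposition42 q isInterlace n _ A simple ks 1≤ks = coeff-≡ (begin
  q (sum ks) (blowup A ks)                         ≈⟨ q-blowup ks ⟩
  Q (blocks id ks)                                 ≈⟨ Q-expand [] id ks ⟩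
  Σᵇ n (λ ℓs → weights ℓs ks *ₚ Q (blocks id ℓs))  ≈⟨ Σᵇ-cong n term≈ ⟩
  qFormula q A ks                                  ∎)
  where
  open ≈-Reasoning
  open Interlace q isInterlace
  open InducedSubgraphs A simple
  term≈ : ∀ ℓs → All (_≤ 1) ℓs →
          weights ℓs ks *ₚ Q (blocks id ℓs)
            ≈ signₚ (n ℕ.+ sum ℓs) *ₚ q (sum ℓs) (blowup A ℓs) *ₚ prodVecₚ (Vec.zipWith rangeFactor ℓs ks)
  term≈ ℓs binary = begin
    weights ℓs ks *ₚ Q (blocks id ℓs)      ≈⟨ *-cong (signed-product ℓs ks binary 1≤ks) (q-blowup ℓs) ⟨
    (σ *ₚ rs) *ₚ q (sum ℓs) (blowup A ℓs)  ≈⟨ swap σ rs (q (sum ℓs) (blowup A ℓs)) ⟩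
    (σ *ₚ q (sum ℓs) (blowup A ℓs)) *ₚ rs  ∎
    where
    σ = signₚ (n ℕ.+ sum ℓs)
    rs = prodVecₚ (Vec.zipWith rangeFactor ℓs ks)
    swap : ∀ a b c → (a *ₚ b) *ₚ c ≈ (a *ₚ c) *ₚ b
    swap = solve-∀ polyACR
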